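{- If $(G,<)=((V,E),<)$ is an ordered graph with $|E|\ge|V|$, then $(G,<)$ contains $K_3$ as an interval minor.
   Context: An ordered graph is a finite simple graph with a linear order on its vertices. $(G,<)$ contains $K_3$ as an interval minor iff $V$ can be partitioned into three nonempty intervals (sets of consecutive vertices) $I_1<I_2<I_3$ such that $G$ has an edge between any two of them. -}

module Defs where

open import Data.Nat using (ℕ; _<_; _≤_)
open import Data.Fin using (Fin; toℕ)
open import Data.Product using (_×_; Σ; ∃; ∃-syntax; _,_; proj₁; proj₂)
open import Data.List using (List; length)
open import Data.List.Relation.Unary.All using (All)
open import Data.List.Relation.Unary.Any using (Any)
open import Data.List.Relation.Unary.Unique.Propositional using (Unique)

-- An ordered graph on n vertices: the vertex set is Fin n with its natural
-- linear order (every finite linearly ordered set is order-isomorphic to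
-- some Fin n).  The edge set is a duplicate-free list of pairs (u , v) with
-- u < v; each unordered edge {u,v} is recorded exactly once as (min , max),
-- so the graph is simple (no loops, no multi-edges) and |E| = length edges.
record OrderedGraph (n : ℕ) : Set where
  field
    edges    : List (Fin n × Fin n)
    ordered  : All (λ e → toℕ (proj₁ e) < toℕ (proj₂ e)) edges
    distinct : Unique edges

open OrderedGraph public

∣V∣ : ∀ {n} → OrderedGraph n → ℕ
∣V∣ {n} _ = n

∣E∣ : ∀ {n} → OrderedGraph n → ℕ
∣E∣ G = length (edges G)

InInterval : ∀ {n} → ℕ → ℕ → Fin n → Set
InInterval lo hi v = lo ≤ toℕ v × toℕ v < hi

-- There is an edge between interval [a1,b1) and interval [a2,b2), where the
-- first interval lies entirely before the second (so the smaller endpoint of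
-- such an edge is in the first interval).
EdgeBetween : ∀ {n} → OrderedGraph n → ℕ → ℕ → ℕ → ℕ → Set
EdgeBetween G a1 b1 a2 b2 =
  Any (λ e → InInterval a1 b1 (proj₁ e) × InInterval a2 b2 (proj₂ e)) (edges G)

-- (G,<) contains K₃ as an interval minor: V = Fin n is partitioned into
-- three nonempty intervals I₁ = [0,a) < I₂ = [a,b) < I₃ = [b,n)
-- (nonempty: 0 < a < b < n) with an edge between any two of them.
ContainsK3IntervalMinor : ∀ {n} → OrderedGraph n → Set
ContainsK3IntervalMinor {n} G =
  ∃[ a ] ∃[ b ] (0 < a × a < b × b < n
    × EdgeBetween G 0 a a b
    × EdgeBetween G 0 a b n
    × EdgeBetween G a b b n)

-- Charge every edge (u , v) to a vertex in {0, …, n-2}: to v if some edge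
-- (u , y) with y > v exists, and to u otherwise.  With |E| ≥ |V| two distinct
-- edges receive the same charge.  In each case of such a collision one finds a
-- "fork" (u , v), (u , y) with v < y together with a "crossing" edge (w , z)
-- with u < w ≤ v < z; then [0, u], [u+1, v], [v+1, n) are the three intervals.
module Submission where

open import Defs
open import Data.Nat using (ℕ; _≥_; _<_; _≤_; _<?_; suc; z≤n; s≤s)
open import Data.Nat.Properties using (<-cmp; ≤-refl; ≤-trans; ≤-<-trans; <⇒≤; ≤-pred)
open import Data.Fin using (Fin; toℕ; fromℕ<) renaming (_≟_ to _≟ᶠ_)
import Data.Fin as Fin
open import Data.Fin.Properties using (pigeonhole; toℕ-injective; toℕ<n; toℕ-fromℕ<)
open import Data.Product using (_×_; ∃₂; _,_; proj₁; proj₂)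
open import Data.List using (List; _∷_; length; lookup)
open import Data.List.Relation.Unary.All as All using (All)
open import Data.List.Relation.Unary.Any using (Any; any?)
open import Data.List.Relation.Unary.AllPairs using (_∷_)
open import Data.List.Relation.Unary.Unique.Propositional using (Unique)
open import Data.List.Membership.Propositional using (_∈_; find; lose)
open import Data.List.Membership.Propositional.Properties using (∈-lookup)
open import Relation.Binary.PropositionalEquality using (_≡_; _≢_; refl; sym; trans; cong; subst)
open import Relation.Binary using (tri<; tri≈; tri>)
open import Relation.Nullary using (Dec; yes; no)
open import Relation.Nullary.Decidable using (_×-dec_)
open import Data.Empty using (⊥-elim)

lookup-injective : ∀ {A : Set} {xs : List A} → Unique xs →
                   ∀ {i j} → i Fin.< j → lookup xs i ≢ lookup xs j
lookup-injective {xs = _ ∷ _} (x∉xs ∷ _) {Fin.zero} {Fin.suc j} _ = All.lookup x∉xs (∈-lookup j)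
lookup-injective {xs = _ ∷ _} (_ ∷ u) {Fin.suc i} {Fin.suc j} (s≤s i<j) = lookup-injective u i<j

unique-pigeonhole : ∀ {A : Set} {xs : List A} {m} (f : A → ℕ) →
                    Unique xs → m < length xs → All (λ x → f x < m) xs →
                    ∃₂ λ x y → x ∈ xs × y ∈ xs × x ≢ y × f x ≡ f y
unique-pigeonhole {xs = xs} f u m<len f<m
  with i , j , i<j , gi≡gj ← pigeonhole m<len (λ i → fromℕ< (All.lookup f<m (∈-lookup i)))
  = lookup xs i , lookup xs j , ∈-lookup i , ∈-lookup j , lookup-injective u i<j ,
    trans (sym (toℕ-fromℕ< _)) (trans (cong toℕ gi≡gj) (toℕ-fromℕ< _))

module _ {n} (G : OrderedGraph n) where

  private
    Edge = Fin n × Fin n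

  ordered-∈ : ∀ {e} → e ∈ edges G → toℕ (proj₁ e) < toℕ (proj₂ e)
  ordered-∈ = All.lookup (ordered G)

  LongerEdgeAt : Edge → Set
  LongerEdgeAt (u , v) = Any (λ e → proj₁ e ≡ u × toℕ v < toℕ (proj₂ e)) (edges G)

  longer? : ∀ e → Dec (LongerEdgeAt e)
  longer? (u , v) = any? (λ e → (proj₁ e ≟ᶠ u) ×-dec (toℕ v <? toℕ (proj₂ e))) (edges G)

  charge : Edge → ℕ
  charge (u , v) with longer? (u , v)
  ... | yes _ = toℕ v
  ... | no _  = toℕ u

  charge-bound : ∀ {e} → e ∈ edges G → suc (charge e) < n
  charge-bound {u , v} e∈G with longer? (u , v)
  ... | yes longer with (_ , y) , _ , refl , v<y ← find longer = ≤-trans (s≤s v<y) (toℕ<n y)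
  ... | no _  = ≤-trans (s≤s (ordered-∈ e∈G)) (toℕ<n v)

  fork-crossing⇒K3 : ∀ {u v w z} → (u , v) ∈ edges G → LongerEdgeAt (u , v) → (w , z) ∈ edges G →
                     toℕ u < toℕ w → toℕ w ≤ toℕ v → toℕ v < toℕ z → ContainsK3IntervalMinor G
  fork-crossing⇒K3 {u} {v} {z = z} uv∈G longer wz∈G u<w w≤v v<z
    with (_ , y) , uy∈G , refl , v<y ← find longer
    = suc (toℕ u) , suc (toℕ v) , s≤s z≤n , s≤s u<v , ≤-<-trans v<y (toℕ<n y) ,
      lose uv∈G ((z≤n , ≤-refl) , (u<v , ≤-refl)) ,
      lose uy∈G ((z≤n , ≤-refl) , (v<y , toℕ<n y)) ,
      lose wz∈G ((u<w , s≤s w≤v) , (v<z , toℕ<n z))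
    where
    u<v : toℕ u < toℕ v
    u<v = ordered-∈ uv∈G

  equal-charge⇒K3 : ∀ {e₁ e₂} → e₁ ∈ edges G → e₂ ∈ edges G → e₁ ≢ e₂ →
                    charge e₁ ≡ charge e₂ → ContainsK3IntervalMinor G
  equal-charge⇒K3 {u₁ , v₁} {u₂ , v₂} e₁∈G e₂∈G e₁≢e₂ eq
    with longer? (u₁ , v₁) | longer? (u₂ , v₂)
  ... | yes longer₁ | yes longer₂ with <-cmp (toℕ u₁) (toℕ u₂)
  ...   | tri< u₁<u₂ _ _
          with (_ , y) , u₂y∈G , refl , v₂<y ← find longer₂
          = fork-crossing⇒K3 e₁∈G longer₁ u₂y∈G u₁<u₂
              (subst (toℕ u₂ ≤_) (sym eq) (<⇒≤ (ordered-∈ e₂∈G))) (subst (_< toℕ y) (sym eq) v₂<y)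
  ...   | tri> _ _ u₂<u₁
          with (_ , y) , u₁y∈G , refl , v₁<y ← find longer₁
          = fork-crossing⇒K3 e₂∈G longer₂ u₁y∈G u₂<u₁
              (subst (toℕ u₁ ≤_) eq (<⇒≤ (ordered-∈ e₁∈G))) (subst (_< toℕ y) eq v₁<y)
  ...   | tri≈ _ u₁≡u₂ _ with refl ← toℕ-injective u₁≡u₂ | refl ← toℕ-injective eq = ⊥-elim (e₁≢e₂ refl)
  equal-charge⇒K3 {u₁ , v₁} {u₂ , v₂} e₁∈G e₂∈G e₁≢e₂ eq | yes longer₁ | no _ =
    fork-crossing⇒K3 e₁∈G longer₁ e₂∈G (subst (toℕ u₁ <_) eq (ordered-∈ e₁∈G))
      (subst (_≤ toℕ v₁) eq ≤-refl) (subst (_< toℕ v₂) (sym eq) (ordered-∈ e₂∈G))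
  equal-charge⇒K3 {u₁ , v₁} {u₂ , v₂} e₁∈G e₂∈G e₁≢e₂ eq | no _ | yes longer₂ =
    fork-crossing⇒K3 e₂∈G longer₂ e₁∈G (subst (toℕ u₂ <_) (sym eq) (ordered-∈ e₂∈G))
      (subst (_≤ toℕ v₂) (sym eq) ≤-refl) (subst (_< toℕ v₁) eq (ordered-∈ e₁∈G))
  equal-charge⇒K3 {u₁ , v₁} {u₂ , v₂} e₁∈G e₂∈G e₁≢e₂ eq | no none₁ | no none₂
    with refl ← toℕ-injective eq | <-cmp (toℕ v₁) (toℕ v₂)
  ... | tri< v₁<v₂ _ _ = ⊥-elim (none₁ (lose e₂∈G (refl , v₁<v₂)))
  ... | tri> _ _ v₂<v₁ = ⊥-elim (none₂ (lose e₁∈G (refl , v₂<v₁)))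
  ... | tri≈ _ v₁≡v₂ _ with refl ← toℕ-injective v₁≡v₂ = ⊥-elim (e₁≢e₂ refl)

lemma29 : (n : ℕ) → 0 < n → (G : OrderedGraph n) → ∣E∣ G ≥ ∣V∣ G → ContainsK3IntervalMinor G
lemma29 (suc m) _ G |E|≥n
  with e₁ , e₂ , e₁∈G , e₂∈G , e₁≢e₂ , same-charge
         ← unique-pigeonhole (charge G) (distinct G) |E|≥n
             (All.tabulate (λ e∈G → ≤-pred (charge-bound G e∈G)))
  = equal-charge⇒K3 G e₁∈G e₂∈G e₁≢e₂ same-charge
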